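{- For every integer $n\ge 1$, there is a bijection between the set $\mathcal{LS}_n$ of little Schröder paths of semilength $n$ and the set $\mathcal{S}_n$ of sequences of nonnegative integers $(u_1,u_2,\dots,u_n)$ such that (i) $u_1=1$, (ii) $u_i\le i$ for all $1\le i\le n$, and (iii) the nonzero entries $u_i$ are weakly increasing (from left to right). In particular, $|\mathcal{S}_n|=|\mathcal{LS}_n|$, which is the $n$-th little Schröder number $s_n$ (so $(s_n)_{n\ge1}=(1,3,11,45,197,\dots)$).
   Context: A Schröder path of semilength $n$ is a lattice path from $(0,0)$ to $(n,n)$ using steps east $E=(1,0)$, north $N=(0,1)$ and diagonal $D=(1,1)$ that never rises above the line $y=x$. A little Schröder path is a Schröder path having no $D$ step lying on the line $y=x$ (i.e., no $D$ step starting on the diagonal). The little Schröder numbers $s_n$ are the numbers of little Schröder paths of semilength $n$ (OEIS A001003). For example $\mathcal{LS}_2=\{EENN, EDN, ENEN\}$ and $\mathcal{S}_2=\{(1,0),(1,1),(1,2)\}$. -}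

module Defs where

open import Data.Nat using (ℕ; zero; suc; _≤_; _<_)
open import Data.Fin using (Fin; toℕ)
open import Data.List using (List; []; _∷_; inits; zip; length)
open import Data.List.Relation.Unary.All using (All)
open import Data.Vec using (Vec; lookup)
open import Data.Product using (Σ; _×_; _,_; proj₁; proj₂)
open import Data.Unit using (⊤)
open import Relation.Binary.PropositionalEquality using (_≡_; _≢_; setoid)
open import Relation.Binary.Bundles using (Setoid)
import Relation.Binary.Construct.On as On

data Step : Set where
  E N D : Step

pos : List Step → ℕ × ℕ
pos [] = 0 , 0
pos (E ∷ s) = let (x , y) = pos s in suc x , y
pos (N ∷ s) = let (x , y) = pos s in x , suc y
pos (D ∷ s) = let (x , y) = pos s in suc x , suc y
-- NB: pos only counts steps, so order does not matter for the end point;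
-- it is applied to prefixes below.

Below : ℕ × ℕ → Set
Below (x , y) = y ≤ x

-- A step taken from the point reached by the given prefix is allowed
-- in a little Schröder path: a D step may not start on the diagonal
-- (given the prefix point satisfies y ≤ x, "not on the diagonal" is y < x).
NoDiagD : List Step × Step → Set
NoDiagD (p , D) = proj₂ (pos p) < proj₁ (pos p)
NoDiagD (p , E) = ⊤
NoDiagD (p , N) = ⊤

record IsSchroder (n : ℕ) (s : List Step) : Set where
  field
    ends  : pos s ≡ (n , n)
    below : All (λ p → Below (pos p)) (inits s)

record IsLittleSchroder (n : ℕ) (s : List Step) : Set where
  field
    schroder : IsSchroder n s
    noDiagD  : All NoDiagD (zip (inits s) s)

LS : ℕ → Setoid _ _
LS n = On.setoid (setoid (List Step)) (proj₁ {B = IsLittleSchroder n})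

-- The set S_n of sequences (u_1,…,u_n) of nonnegative integers
-- (index i : Fin n stands for position toℕ i + 1) with
-- (i) u_1 = 1, (ii) u_i ≤ i, (iii) nonzero entries weakly increasing.
record IsSeqS (n : ℕ) (u : Vec ℕ n) : Set where
  field
    first   : (i : Fin n) → toℕ i ≡ 0 → lookup u i ≡ 1
    bounded : (i : Fin n) → lookup u i ≤ suc (toℕ i)
    incr    : (i j : Fin n) → toℕ i < toℕ j →
              lookup u i ≢ 0 → lookup u j ≢ 0 → lookup u i ≤ lookup u j

Seqs : ℕ → Setoid _ _
Seqs n = On.setoid (setoid (Vec ℕ n)) (proj₁ {B = IsSeqS n})

-- Measuring height by x − y, a little Schröder path is a walk with up steps E,
-- down steps N and level steps D that stays at height ≥ 0 and has no D at
-- height 0; it parses into a forest of blocks E a N and D, with no D at top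
-- level. Inside a block, cut the forest at its first top-level D: the forest
-- after it becomes the contents of a marked arch D a N placed first, followed
-- by the arches before it. This rotation identifies the paths with Dyck words
-- over up steps E, D and down steps N in which D only follows an up step. Such
-- a word is recorded by the sequence with u_i = 0 when the i-th up step is D
-- and u_i = 1 + (number of earlier down steps) otherwise; staying at height
-- ≥ 0 is u_i ≤ i, and the nonzero entries grow with the number of down steps.
module Submission where

open import Defs
open import Data.Bool using (Bool; true; false)
open import Data.Fin using (Fin; zero; suc; toℕ)
open import Data.List using (List; []; _∷_; _++_; map; zip; inits)
open import Data.List.Properties using (++-assoc; ++-identityʳ)
open import Data.List.Relation.Unary.All using (All; []; _∷_)
import Data.List.Relation.Unary.All as All
import Data.List.Relation.Unary.All.Properties as All
open import Data.Nat
open import Data.Nat.Properties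
open import Data.Product using (Σ; _×_; _,_; proj₁; proj₂; map₁)
open import Data.Unit using (⊤; tt)
open import Data.Vec using (Vec; []; _∷_; head; replicate; lookup; updateAt)
open import Data.Vec.Properties using (updateAt-id)
open import Data.Vec.Relation.Unary.All using ([]; _∷_) renaming (All to Allᵛ)
open import Function.Base using (id; _∘_)
open import Function.Bundles using (Bijection; Inverse; _⇔_; mk⇔; Equivalence)
open import Function.Construct.Composition using (inverse)
open import Function.Properties.Inverse using (Inverse⇒Bijection)
open import Relation.Binary.Bundles using (Setoid)
import Relation.Binary.Construct.On as On
open import Relation.Binary.PropositionalEquality
open import Relation.Nullary using (contradiction)

Subset : {A : Set} → (A → Set) → Setoid _ _
Subset {A} P = On.setoid (setoid A) (proj₁ {B = P})

record _≅_ {A B : Set} (P : A → Set) (Q : B → Set) : Set where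
  field
    to      : A → B
    from    : B → A
    to-∈    : ∀ {a} → P a → Q (to a)
    from-∈  : ∀ {b} → Q b → P (from b)
    from∘to : ∀ {a} → P a → from (to a) ≡ a
    to∘from : ∀ {b} → Q b → to (from b) ≡ b

≅⇒Inverse : {A B : Set} {P : A → Set} {Q : B → Set} → P ≅ Q → Inverse (Subset P) (Subset Q)
≅⇒Inverse I = record
  { to        = λ (a , p) → to a , to-∈ p
  ; from      = λ (b , q) → from b , from-∈ q
  ; to-cong   = cong to
  ; from-cong = cong from
  ; inverse   = (λ {(_ , q)} eq → trans (cong to eq) (to∘from q))
              , (λ {(_ , p)} eq → trans (cong from eq) (from∘to p))
  }
  where open _≅_ I

infixr 9 _⨾_
_⨾_ : ∀ {a b c ℓ₁ ℓ₂ ℓ₃} {R : Setoid a ℓ₁} {S : Setoid b ℓ₂} {T : Setoid c ℓ₃} →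
      Inverse R S → Inverse S T → Inverse R T
_⨾_ = inverse

-- Little Schröder paths as walks

xCoord yCoord : List Step → ℕ
xCoord s = proj₁ (pos s)
yCoord s = proj₂ (pos s)

data Walk : ℕ → List Step → Set where
  done  : Walk 0 []
  stepE : ∀ {h s} → Walk (suc h) s → Walk h (E ∷ s)
  stepN : ∀ {h s} → Walk h s → Walk (suc h) (N ∷ s)
  stepD : ∀ {h s} → Walk (suc h) s → Walk (suc h) (D ∷ s)

-- The conditions defining little Schröder paths, for a path starting at (h , 0).
Clear : ℕ → ℕ → List Step → Set
Clear k h p = k + yCoord p ≤ h + xCoord p

NoDiagDFrom : ℕ → List Step × Step → Set
NoDiagDFrom h (p , E) = ⊤
NoDiagDFrom h (p , N) = ⊤
NoDiagDFrom h (p , D) = Clear 1 h p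

record Admissible (h : ℕ) (s : List Step) : Set where
  field
    below   : All (Clear 0 h) (inits s)
    noDiagD : All (NoDiagDFrom h) (zip (inits s) s)
    ends    : h + xCoord s ≡ yCoord s

clear-E : ∀ {k h} p → Clear k (suc h) p ⇔ Clear k h (E ∷ p)
clear-E {k} {h} p = mk⇔ (subst (k + yCoord p ≤_) (sym (+-suc h (xCoord p))))
                        (subst (k + yCoord p ≤_) (+-suc h (xCoord p)))

clear-N : ∀ {k h} p → Clear k h p ⇔ Clear k (suc h) (N ∷ p)
clear-N {k} {h} p = mk⇔ (λ c → subst (_≤ suc (h + xCoord p)) (sym (+-suc k (yCoord p))) (s≤s c))
                        (λ c → s≤s⁻¹ (subst (_≤ suc (h + xCoord p)) (+-suc k (yCoord p)) c))

clear-D : ∀ {k h} p → Clear k h p ⇔ Clear k h (D ∷ p)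
clear-D {k} {h} p =
  mk⇔ (λ c → subst₂ _≤_ (sym (+-suc k (yCoord p))) (sym (+-suc h (xCoord p))) (s≤s c))
      (λ c → s≤s⁻¹ (subst₂ _≤_ (+-suc k (yCoord p)) (+-suc h (xCoord p)) c))

zip-map₁ : {A B C : Set} (f : A → C) (xs : List A) (ys : List B) →
           zip (map f xs) ys ≡ map (map₁ f) (zip xs ys)
zip-map₁ f []       ys       = refl
zip-map₁ f (x ∷ xs) []       = refl
zip-map₁ f (x ∷ xs) (y ∷ ys) = cong (_ ∷_) (zip-map₁ f xs ys)

admissible-∷ : ∀ {h h′} c s →
  (∀ {k} p → Clear k h′ p ⇔ Clear k h (c ∷ p)) → NoDiagDFrom h ([] , c) →
  (h′ + xCoord s ≡ yCoord s ⇔ h + xCoord (c ∷ s) ≡ yCoord (c ∷ s)) →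
  Admissible h′ s ⇔ Admissible h (c ∷ s)
admissible-∷ {h} {h′} c s clear first ends = mk⇔
  (λ a → record
    { below   = z≤n ∷ All.map⁺ (All.map (Equivalence.to (clear _)) (Admissible.below a))
    ; noDiagD = first ∷ subst (All (NoDiagDFrom h)) (sym (zip-map₁ (c ∷_) (inits s) s))
                          (All.map⁺ (All.map (λ {q} → Equivalence.to (noDiag q)) (Admissible.noDiagD a)))
    ; ends    = Equivalence.to ends (Admissible.ends a)
    })
  (λ a → record
    { below   = All.map (Equivalence.from (clear _)) (All.map⁻ (All.tail (Admissible.below a)))
    ; noDiagD = All.map (λ {q} → Equivalence.from (noDiag q))
                  (All.map⁻ (subst (All (NoDiagDFrom h)) (zip-map₁ (c ∷_) (inits s) s)
                                   (All.tail (Admissible.noDiagD a))))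
    ; ends    = Equivalence.from ends (Admissible.ends a)
    })
  where
  noDiag : ∀ q → NoDiagDFrom h′ q ⇔ NoDiagDFrom h (map₁ (c ∷_) q)
  noDiag (p , E) = mk⇔ id id
  noDiag (p , N) = mk⇔ id id
  noDiag (p , D) = clear p

admissible-E : ∀ {h} s → Admissible (suc h) s ⇔ Admissible h (E ∷ s)
admissible-E {h} s = admissible-∷ E s clear-E tt
  (mk⇔ (trans (+-suc h (xCoord s))) (trans (sym (+-suc h (xCoord s)))))

admissible-N : ∀ {h} s → Admissible h s ⇔ Admissible (suc h) (N ∷ s)
admissible-N s = admissible-∷ N s clear-N tt (mk⇔ (cong suc) suc-injective)

admissible-D : ∀ {h} s → Admissible (suc h) s ⇔ Admissible (suc h) (D ∷ s)
admissible-D {h} s = admissible-∷ D s clear-D (s≤s z≤n)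
  (mk⇔ (λ e → trans (+-suc (suc h) (xCoord s)) (cong suc e))
       (λ e → suc-injective (trans (sym (+-suc (suc h) (xCoord s))) e)))

walk⇒admissible : ∀ {h s} → Walk h s → Admissible h s
walk⇒admissible done      = record { below = z≤n ∷ [] ; noDiagD = [] ; ends = refl }
walk⇒admissible (stepE w) = Equivalence.to (admissible-E _) (walk⇒admissible w)
walk⇒admissible (stepN w) = Equivalence.to (admissible-N _) (walk⇒admissible w)
walk⇒admissible (stepD w) = Equivalence.to (admissible-D _) (walk⇒admissible w)

admissible⇒walk : ∀ {h} s → Admissible h s → Walk h s
admissible⇒walk {zero}  []      a = done
admissible⇒walk {suc h} []      a with () ← Admissible.ends a
admissible⇒walk         (E ∷ s) a = stepE (admissible⇒walk s (Equivalence.from (admissible-E s) a))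
admissible⇒walk {zero}  (N ∷ s) a with _ ∷ () ∷ _ ← Admissible.below a
admissible⇒walk {suc h} (N ∷ s) a = stepN (admissible⇒walk s (Equivalence.from (admissible-N s) a))
admissible⇒walk {zero}  (D ∷ s) a with () ∷ _ ← Admissible.noDiagD a
admissible⇒walk {suc h} (D ∷ s) a = stepD (admissible⇒walk s (Equivalence.from (admissible-D s) a))

LSWalk : ℕ → List Step → Set
LSWalk n s = Walk 0 s × xCoord s ≡ n

littleSchröder≅walk : ∀ n → IsLittleSchroder n ≅ LSWalk n
littleSchröder≅walk n = record
  { to      = id
  ; from    = id
  ; to-∈    = λ ls → admissible⇒walk _ (admissible ls) ,
                     cong proj₁ (IsSchroder.ends (IsLittleSchroder.schroder ls))
  ; from-∈  = littleSchröder
  ; from∘to = λ _ → refl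
  ; to∘from = λ _ → refl
  }
  where
  noDiag : ∀ q → NoDiagD q ⇔ NoDiagDFrom 0 q
  noDiag (p , E) = mk⇔ id id
  noDiag (p , N) = mk⇔ id id
  noDiag (p , D) = mk⇔ id id

  admissible : ∀ {s} → IsLittleSchroder n s → Admissible 0 s
  admissible ls = record
    { below   = below
    ; noDiagD = All.map (λ {q} → Equivalence.to (noDiag q)) (IsLittleSchroder.noDiagD ls)
    ; ends    = trans (cong proj₁ ends) (sym (cong proj₂ ends))
    }
    where open IsSchroder (IsLittleSchroder.schroder ls)

  littleSchröder : ∀ {s} → LSWalk n s → IsLittleSchroder n s
  littleSchröder {s} (w , refl) = record
    { schroder = record { ends = cong (xCoord s ,_) (sym ends) ; below = below }
    ; noDiagD  = All.map (λ {q} → Equivalence.from (noDiag q)) noDiagD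
    }
    where open Admissible (walk⇒admissible w)

-- Schröder forests

xCoord-++ : ∀ s t → xCoord (s ++ t) ≡ xCoord s + xCoord t
xCoord-++ []      t = refl
xCoord-++ (E ∷ s) t = cong suc (xCoord-++ s t)
xCoord-++ (N ∷ s) t = xCoord-++ s t
xCoord-++ (D ∷ s) t = cong suc (xCoord-++ s t)

infixr 5 ⟨_⟩∷_ D∷_ _++ᶠ_

data Forest : Set where
  []    : Forest
  ⟨_⟩∷_ : Forest → Forest → Forest
  D∷_   : Forest → Forest

word : Forest → List Step
word []         = []
word (⟨ a ⟩∷ b) = E ∷ word a ++ N ∷ word b
word (D∷ a)     = D ∷ word a

size : Forest → ℕ
size []         = 0
size (⟨ a ⟩∷ b) = suc (size a + size b)
size (D∷ a)     = suc (size a)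

data NoTopD : Forest → Set where
  []    : NoTopD []
  ⟨_⟩∷_ : ∀ a {b} → NoTopD b → NoTopD (⟨ a ⟩∷ b)

_++ᶠ_ : Forest → Forest → Forest
[]         ++ᶠ c = c
(⟨ a ⟩∷ b) ++ᶠ c = ⟨ a ⟩∷ (b ++ᶠ c)
(D∷ a)     ++ᶠ c = D∷ (a ++ᶠ c)

++ᶠ-identityʳ : ∀ a → a ++ᶠ [] ≡ a
++ᶠ-identityʳ []         = refl
++ᶠ-identityʳ (⟨ a ⟩∷ b) = cong (⟨ a ⟩∷_) (++ᶠ-identityʳ b)
++ᶠ-identityʳ (D∷ a)     = cong D∷_ (++ᶠ-identityʳ a)

++ᶠ-assoc : ∀ a b c → (a ++ᶠ b) ++ᶠ c ≡ a ++ᶠ (b ++ᶠ c)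
++ᶠ-assoc []          b c = refl
++ᶠ-assoc (⟨ a ⟩∷ a′) b c = cong (⟨ a ⟩∷_) (++ᶠ-assoc a′ b c)
++ᶠ-assoc (D∷ a)      b c = cong D∷_ (++ᶠ-assoc a b c)

size-++ᶠ : ∀ a b → size (a ++ᶠ b) ≡ size a + size b
size-++ᶠ []          b = refl
size-++ᶠ (⟨ a ⟩∷ a′) b = cong suc (begin
  size a + size (a′ ++ᶠ b)    ≡⟨ cong (size a +_) (size-++ᶠ a′ b) ⟩
  size a + (size a′ + size b) ≡⟨ +-assoc (size a) (size a′) (size b) ⟨
  size a + size a′ + size b   ∎)
  where open ≡-Reasoning
size-++ᶠ (D∷ a)      b = cong suc (size-++ᶠ a b)

xCoord-word : ∀ a → xCoord (word a) ≡ size a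
xCoord-word []         = refl
xCoord-word (⟨ a ⟩∷ b) =
  cong suc (trans (xCoord-++ (word a) (N ∷ word b)) (cong₂ _+_ (xCoord-word a) (xCoord-word b)))
xCoord-word (D∷ a)     = cong suc (xCoord-word a)

walk-word : ∀ a {h s} → Walk (suc h) s → Walk (suc h) (word a ++ s)
walk-word []         w = w
walk-word (⟨ a ⟩∷ b) {s = s} w rewrite ++-assoc (word a) (N ∷ word b) s =
  stepE (walk-word a (stepN (walk-word b w)))
walk-word (D∷ a)     w = stepD (walk-word a w)

walk-word-noTopD : ∀ {a} → NoTopD a → ∀ {h s} → Walk h s → Walk h (word a ++ s)
walk-word-noTopD []                  w = w
walk-word-noTopD (⟨_⟩∷_ a {b} noD) {s = s} w rewrite ++-assoc (word a) (N ∷ word b) s =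
  stepE (walk-word a (stepN (walk-word-noTopD noD w)))

-- parse h s cuts a walk from height h at its h unmatched N steps into h + 1
-- forests (the inverse of stackWord below); the clause for N at height 0 is junk.
parse : (h : ℕ) → List Step → Vec Forest (suc h)
parse h       []      = replicate _ []
parse h       (E ∷ s) with parse (suc h) s
... | a ∷ b ∷ r = (⟨ a ⟩∷ b) ∷ r
parse zero    (N ∷ s) = parse zero s
parse (suc h) (N ∷ s) = [] ∷ parse h s
parse h       (D ∷ s) = updateAt (parse h s) zero D∷_

closedWord : ∀ {h} → Vec Forest h → List Step
closedWord []      = []
closedWord (b ∷ r) = N ∷ word b ++ closedWord r

stackWord : ∀ {h} → Vec Forest (suc h) → List Step
stackWord (a ∷ r) = word a ++ closedWord r

stackWord-parse : ∀ {h s} → Walk h s → stackWord (parse h s) ≡ s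
stackWord-parse done = refl
stackWord-parse {h} (stepE {s = s} w) with parse (suc h) s | stackWord-parse w
... | a ∷ b ∷ r | ih = cong (E ∷_) (trans (++-assoc (word a) (N ∷ word b) (closedWord r)) ih)
stackWord-parse {suc h} (stepN {s = s} w) with parse h s | stackWord-parse w
... | a ∷ r | ih = cong (N ∷_) ih
stackWord-parse {suc h} (stepD {s = s} w) with parse (suc h) s | stackWord-parse w
... | a ∷ r | ih = cong (D ∷_) ih

parse-word-++ : ∀ a h s → parse h (word a ++ s) ≡ updateAt (parse h s) zero (a ++ᶠ_)
parse-word-++ [] h s = sym (updateAt-id zero (parse h s))
parse-word-++ (⟨ a ⟩∷ b) h s
  rewrite ++-assoc (word a) (N ∷ word b) s
        | parse-word-++ a (suc h) (N ∷ word b ++ s)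
        | parse-word-++ b h s
        | ++ᶠ-identityʳ a
  with parse h s
... | x ∷ r = refl
parse-word-++ (D∷ a) h s rewrite parse-word-++ a h s with parse h s
... | x ∷ r = refl

parse-word : ∀ a → head (parse 0 (word a)) ≡ a
parse-word a = begin
  head (parse 0 (word a))      ≡⟨ cong (head ∘ parse 0) (++-identityʳ (word a)) ⟨
  head (parse 0 (word a ++ [])) ≡⟨ cong head (parse-word-++ a 0 []) ⟩
  a ++ᶠ []                      ≡⟨ ++ᶠ-identityʳ a ⟩
  a                             ∎
  where open ≡-Reasoning

bottom : {A : Set} {h : ℕ} → Vec A (suc h) → A
bottom (a ∷ [])    = a
bottom (a ∷ b ∷ r) = bottom (b ∷ r)

noTopD-parse : ∀ {h s} → Walk h s → NoTopD (bottom (parse h s))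
noTopD-parse done = []
noTopD-parse {zero} (stepE {s = s} w) with parse 1 s | noTopD-parse w
... | a ∷ b ∷ [] | noD = ⟨ a ⟩∷ noD
noTopD-parse {suc h} (stepE {s = s} w) with parse (suc (suc h)) s | noTopD-parse w
... | a ∷ b ∷ c ∷ r | noD = noD
noTopD-parse {suc h} (stepN {s = s} w) with parse h s | noTopD-parse w
... | a ∷ r | noD = noD
noTopD-parse {suc h} (stepD {s = s} w) with parse (suc h) s | noTopD-parse w
... | a ∷ b ∷ r | noD = noD

ForestOf : ℕ → Forest → Set
ForestOf n a = NoTopD a × size a ≡ n

walk≅forest : ∀ n → LSWalk n ≅ ForestOf n
walk≅forest n = record
  { to      = head ∘ parse 0
  ; from    = word
  ; to-∈    = λ (w , x≡n) →
      noTopD₀ w , trans (sym (xCoord-word _)) (trans (cong xCoord (word-parse₀ w)) x≡n)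
  ; from-∈  = λ {a} (noD , size≡n) →
      subst (Walk 0) (++-identityʳ (word a)) (walk-word-noTopD noD done) , trans (xCoord-word a) size≡n
  ; from∘to = λ (w , _) → word-parse₀ w
  ; to∘from = λ {a} _ → parse-word a
  }
  where
  word-parse₀ : ∀ {s} → Walk 0 s → word (head (parse 0 s)) ≡ s
  word-parse₀ {s} w with parse 0 s | stackWord-parse w
  ... | a ∷ [] | eq = trans (sym (++-identityʳ (word a))) eq

  noTopD₀ : ∀ {s} → Walk 0 s → NoTopD (head (parse 0 s))
  noTopD₀ {s} w with parse 0 s | noTopD-parse w
  ... | a ∷ [] | noD = noD

-- Marked forests and the rotation

infixr 5 ⟨_⟩ᵐ∷_

-- Forests of arches E a N, each of which may be marked as D a N.
data MForest : Set where
  []     : MForest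
  ⟨_⟩∷_  : MForest → MForest → MForest
  ⟨_⟩ᵐ∷_ : MForest → MForest → MForest

msize : MForest → ℕ
msize []          = 0
msize (⟨ a ⟩∷ b)  = suc (msize a + msize b)
msize (⟨ a ⟩ᵐ∷ b) = suc (msize a + msize b)

data WellMarked : Bool → MForest → Set where
  []     : ∀ {m} → WellMarked m []
  ⟨_⟩∷_  : ∀ {m a b} → WellMarked true a → WellMarked false b → WellMarked m (⟨ a ⟩∷ b)
  ⟨_⟩ᵐ∷_ : ∀ {a b} → WellMarked true a → WellMarked false b → WellMarked true (⟨ a ⟩ᵐ∷ b)

wellMarked-weaken : ∀ {m a} → WellMarked false a → WellMarked m a
wellMarked-weaken []          = []
wellMarked-weaken (⟨ a ⟩∷ b) = ⟨ a ⟩∷ b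

unmark : MForest → Forest
unmark []          = []
unmark (⟨ a ⟩∷ b)  = ⟨ unmark a ⟩∷ unmark b
unmark (⟨ a ⟩ᵐ∷ b) = unmark b ++ᶠ D∷ unmark a

arches : List MForest → MForest → MForest
arches []       r = r
arches (x ∷ xs) r = arches xs (⟨ x ⟩∷ r)

mutual
  mark : Forest → MForest
  mark s = markFrom s []

  markFrom : Forest → List MForest → MForest
  markFrom []         acc = arches acc []
  markFrom (⟨ a ⟩∷ b) acc = markFrom b (mark a ∷ acc)
  markFrom (D∷ c)     acc = ⟨ mark c ⟩ᵐ∷ arches acc []

unmark-arches : ∀ acc r → unmark (arches acc r) ≡ unmark (arches acc []) ++ᶠ unmark r
unmark-arches []        r = refl
unmark-arches (x ∷ acc) r = begin
  unmark (arches acc (⟨ x ⟩∷ r))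
    ≡⟨ unmark-arches acc (⟨ x ⟩∷ r) ⟩
  unmark (arches acc []) ++ᶠ ⟨ unmark x ⟩∷ unmark r
    ≡⟨ ++ᶠ-assoc (unmark (arches acc [])) _ _ ⟨
  (unmark (arches acc []) ++ᶠ ⟨ unmark x ⟩∷ []) ++ᶠ unmark r
    ≡⟨ cong (_++ᶠ unmark r) (unmark-arches acc (⟨ x ⟩∷ [])) ⟨
  unmark (arches acc (⟨ x ⟩∷ [])) ++ᶠ unmark r
    ∎
  where open ≡-Reasoning

unmark-markFrom : ∀ s acc → unmark (markFrom s acc) ≡ unmark (arches acc []) ++ᶠ s
unmark-markFrom []         acc = sym (++ᶠ-identityʳ _)
unmark-markFrom (⟨ a ⟩∷ b) acc = begin
  unmark (markFrom b (mark a ∷ acc))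
    ≡⟨ unmark-markFrom b (mark a ∷ acc) ⟩
  unmark (arches acc (⟨ mark a ⟩∷ [])) ++ᶠ b
    ≡⟨ cong (_++ᶠ b) (unmark-arches acc (⟨ mark a ⟩∷ [])) ⟩
  (unmark (arches acc []) ++ᶠ ⟨ unmark (mark a) ⟩∷ []) ++ᶠ b
    ≡⟨ ++ᶠ-assoc (unmark (arches acc [])) _ b ⟩
  unmark (arches acc []) ++ᶠ ⟨ unmark (mark a) ⟩∷ b
    ≡⟨ cong (λ a′ → unmark (arches acc []) ++ᶠ ⟨ a′ ⟩∷ b) (unmark-markFrom a []) ⟩
  unmark (arches acc []) ++ᶠ ⟨ a ⟩∷ b
    ∎
  where open ≡-Reasoning
unmark-markFrom (D∷ c)     acc = cong (λ c′ → unmark (arches acc []) ++ᶠ D∷ c′) (unmark-markFrom c [])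

unmark-mark : ∀ s → unmark (mark s) ≡ s
unmark-mark s = unmark-markFrom s []

pushArches : MForest → List MForest → List MForest
pushArches []          acc = acc
pushArches (⟨ a ⟩∷ b)  acc = pushArches b (a ∷ acc)
pushArches (⟨ a ⟩ᵐ∷ b) acc = acc

arches-pushArches : ∀ {t} → WellMarked false t → ∀ acc → arches (pushArches t acc) [] ≡ arches acc t
arches-pushArches []                     acc = refl
arches-pushArches (⟨_⟩∷_ {a = a} _ wb) acc = arches-pushArches wb (a ∷ acc)

mutual
  mark-unmark : ∀ {m t} → WellMarked m t → mark (unmark t) ≡ t
  mark-unmark [] = refl
  mark-unmark (⟨_⟩∷_ {a = a} {b} wa wb) = begin
    markFrom (unmark b) (mark (unmark a) ∷ [])
      ≡⟨ cong (λ a′ → markFrom (unmark b) (a′ ∷ [])) (mark-unmark wa) ⟩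
    markFrom (unmark b) (a ∷ [])
      ≡⟨ cong (λ b′ → markFrom b′ (a ∷ [])) (++ᶠ-identityʳ (unmark b)) ⟨
    markFrom (unmark b ++ᶠ []) (a ∷ [])
      ≡⟨ markFrom-unmark wb [] (a ∷ []) ⟩
    arches (pushArches b (a ∷ [])) []
      ≡⟨ arches-pushArches wb (a ∷ []) ⟩
    ⟨ a ⟩∷ b
      ∎
    where open ≡-Reasoning
  mark-unmark (⟨_⟩ᵐ∷_ {a = a} {b} wa wb) =
    trans (markFrom-unmark wb (D∷ unmark a) [])
          (cong₂ ⟨_⟩ᵐ∷_ (mark-unmark wa) (arches-pushArches wb []))

  markFrom-unmark : ∀ {t} → WellMarked false t → ∀ s acc →
                    markFrom (unmark t ++ᶠ s) acc ≡ markFrom s (pushArches t acc)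
  markFrom-unmark []                        s acc = refl
  markFrom-unmark (⟨_⟩∷_ {a = a} {b} wa wb) s acc =
    trans (cong (λ a′ → markFrom (unmark b ++ᶠ s) (a′ ∷ acc)) (mark-unmark wa))
          (markFrom-unmark wb s (a ∷ acc))

wellMarked-arches : ∀ {m acc r} → All (WellMarked true) acc → WellMarked false r →
                    WellMarked m (arches acc r)
wellMarked-arches []         wr = wellMarked-weaken wr
wellMarked-arches (wx ∷ wxs) wr = wellMarked-arches wxs (⟨ wx ⟩∷ wr)

wellMarked-markFrom : ∀ s {acc} → All (WellMarked true) acc → WellMarked true (markFrom s acc)
wellMarked-markFrom []         wacc = wellMarked-arches wacc []
wellMarked-markFrom (⟨ a ⟩∷ b) wacc = wellMarked-markFrom b (wellMarked-markFrom a [] ∷ wacc)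
wellMarked-markFrom (D∷ c)     wacc = ⟨ wellMarked-markFrom c [] ⟩ᵐ∷ wellMarked-arches wacc []

wellMarked-markFrom-noTopD : ∀ {s} → NoTopD s → ∀ {acc} → All (WellMarked true) acc →
                             WellMarked false (markFrom s acc)
wellMarked-markFrom-noTopD []          wacc = wellMarked-arches wacc []
wellMarked-markFrom-noTopD (⟨ a ⟩∷ nb) wacc =
  wellMarked-markFrom-noTopD nb (wellMarked-markFrom a [] ∷ wacc)

noTopD-unmark : ∀ {t} → WellMarked false t → NoTopD (unmark t)
noTopD-unmark []                  = []
noTopD-unmark (⟨_⟩∷_ {a = a} _ wb) = ⟨ unmark a ⟩∷ noTopD-unmark wb

size-unmark : ∀ t → size (unmark t) ≡ msize t
size-unmark []          = refl
size-unmark (⟨ a ⟩∷ b)  = cong suc (cong₂ _+_ (size-unmark a) (size-unmark b))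
size-unmark (⟨ a ⟩ᵐ∷ b) = begin
  size (unmark b ++ᶠ D∷ unmark a)        ≡⟨ size-++ᶠ (unmark b) (D∷ unmark a) ⟩
  size (unmark b) + suc (size (unmark a)) ≡⟨ +-suc (size (unmark b)) _ ⟩
  suc (size (unmark b) + size (unmark a)) ≡⟨ cong suc (+-comm (size (unmark b)) _) ⟩
  suc (size (unmark a) + size (unmark b)) ≡⟨ cong suc (cong₂ _+_ (size-unmark a) (size-unmark b)) ⟩
  suc (msize a + msize b)                ∎
  where open ≡-Reasoning

MForestOf : ℕ → MForest → Set
MForestOf n t = WellMarked false t × msize t ≡ n

forest≅markedForest : ∀ n → ForestOf n ≅ MForestOf n
forest≅markedForest n = record
  { to      = mark
  ; from    = unmark
  ; to-∈    = λ {s} (noD , size≡n) →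
      wellMarked-markFrom-noTopD noD [] ,
      trans (sym (size-unmark (mark s))) (trans (cong size (unmark-mark s)) size≡n)
  ; from-∈  = λ {t} (wt , size≡n) → noTopD-unmark wt , trans (size-unmark t) size≡n
  ; from∘to = λ {s} _ → unmark-mark s
  ; to∘from = λ (wt , _) → mark-unmark wt
  }

-- Marked Dyck words

infixr 5 _++ᵐ_

-- MWalk h m s: as Walk, but with D an up step allowed only directly after an
-- up step; m says whether s may start with D.
data MWalk : ℕ → Bool → List Step → Set where
  end   : ∀ {m} → MWalk 0 m []
  upE   : ∀ {h m s} → MWalk (suc h) true s → MWalk h m (E ∷ s)
  upD   : ∀ {h s} → MWalk (suc h) true s → MWalk h true (D ∷ s)
  downN : ∀ {h m s} → MWalk h false s → MWalk (suc h) m (N ∷ s)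

mword : MForest → List Step
mword []          = []
mword (⟨ a ⟩∷ b)  = E ∷ mword a ++ N ∷ mword b
mword (⟨ a ⟩ᵐ∷ b) = D ∷ mword a ++ N ∷ mword b

_++ᵐ_ : MForest → MForest → MForest
[]          ++ᵐ c = c
(⟨ a ⟩∷ b)  ++ᵐ c = ⟨ a ⟩∷ (b ++ᵐ c)
(⟨ a ⟩ᵐ∷ b) ++ᵐ c = ⟨ a ⟩ᵐ∷ (b ++ᵐ c)

++ᵐ-identityʳ : ∀ a → a ++ᵐ [] ≡ a
++ᵐ-identityʳ []          = refl
++ᵐ-identityʳ (⟨ a ⟩∷ b)  = cong (⟨ a ⟩∷_) (++ᵐ-identityʳ b)
++ᵐ-identityʳ (⟨ a ⟩ᵐ∷ b) = cong (⟨ a ⟩ᵐ∷_) (++ᵐ-identityʳ b)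

xCoord-mword : ∀ t → xCoord (mword t) ≡ msize t
xCoord-mword []          = refl
xCoord-mword (⟨ a ⟩∷ b)  =
  cong suc (trans (xCoord-++ (mword a) (N ∷ mword b)) (cong₂ _+_ (xCoord-mword a) (xCoord-mword b)))
xCoord-mword (⟨ a ⟩ᵐ∷ b) =
  cong suc (trans (xCoord-++ (mword a) (N ∷ mword b)) (cong₂ _+_ (xCoord-mword a) (xCoord-mword b)))

mayMarkAfter : Bool → MForest → Bool
mayMarkAfter m []          = m
mayMarkAfter m (⟨ _ ⟩∷ _)  = false
mayMarkAfter m (⟨ _ ⟩ᵐ∷ _) = false

mayMarkAfter-false : ∀ t → mayMarkAfter false t ≡ false
mayMarkAfter-false []          = refl
mayMarkAfter-false (⟨ _ ⟩∷ _)  = refl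
mayMarkAfter-false (⟨ _ ⟩ᵐ∷ _) = refl

mwalk-mword : ∀ {m t} → WellMarked m t → ∀ {h s} → MWalk h (mayMarkAfter m t) s →
              MWalk h m (mword t ++ s)
mwalk-mword []                         w = w
mwalk-mword (⟨_⟩∷_ {a = a} {b} wa wb)  {s = s} w rewrite ++-assoc (mword a) (N ∷ mword b) s =
  upE (mwalk-mword wa (downN (mwalk-mword wb (subst (λ m → MWalk _ m s) (sym (mayMarkAfter-false b)) w))))
mwalk-mword (⟨_⟩ᵐ∷_ {a = a} {b} wa wb) {s = s} w rewrite ++-assoc (mword a) (N ∷ mword b) s =
  upD (mwalk-mword wa (downN (mwalk-mword wb (subst (λ m → MWalk _ m s) (sym (mayMarkAfter-false b)) w))))

mparse : (h : ℕ) → List Step → Vec MForest (suc h)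
mparse h       []      = replicate _ []
mparse h       (E ∷ s) with mparse (suc h) s
... | a ∷ b ∷ r = (⟨ a ⟩∷ b) ∷ r
mparse h       (D ∷ s) with mparse (suc h) s
... | a ∷ b ∷ r = (⟨ a ⟩ᵐ∷ b) ∷ r
mparse zero    (N ∷ s) = mparse zero s
mparse (suc h) (N ∷ s) = [] ∷ mparse h s

mclosedWord : ∀ {h} → Vec MForest h → List Step
mclosedWord []      = []
mclosedWord (b ∷ r) = N ∷ mword b ++ mclosedWord r

mstackWord : ∀ {h} → Vec MForest (suc h) → List Step
mstackWord (a ∷ r) = mword a ++ mclosedWord r

mstackWord-mparse : ∀ {h m s} → MWalk h m s → mstackWord (mparse h s) ≡ s
mstackWord-mparse end = refl
mstackWord-mparse {h} (upE {s = s} w) with mparse (suc h) s | mstackWord-mparse w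
... | a ∷ b ∷ r | ih = cong (E ∷_) (trans (++-assoc (mword a) (N ∷ mword b) (mclosedWord r)) ih)
mstackWord-mparse {h} (upD {s = s} w) with mparse (suc h) s | mstackWord-mparse w
... | a ∷ b ∷ r | ih = cong (D ∷_) (trans (++-assoc (mword a) (N ∷ mword b) (mclosedWord r)) ih)
mstackWord-mparse {suc h} (downN {s = s} w) with mparse h s | mstackWord-mparse w
... | a ∷ r | ih = cong (N ∷_) ih

mparse-mword-++ : ∀ t h s → mparse h (mword t ++ s) ≡ updateAt (mparse h s) zero (t ++ᵐ_)
mparse-mword-++ [] h s = sym (updateAt-id zero (mparse h s))
mparse-mword-++ (⟨ a ⟩∷ b) h s
  rewrite ++-assoc (mword a) (N ∷ mword b) s
        | mparse-mword-++ a (suc h) (N ∷ mword b ++ s)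
        | mparse-mword-++ b h s
        | ++ᵐ-identityʳ a
  with mparse h s
... | x ∷ r = refl
mparse-mword-++ (⟨ a ⟩ᵐ∷ b) h s
  rewrite ++-assoc (mword a) (N ∷ mword b) s
        | mparse-mword-++ a (suc h) (N ∷ mword b ++ s)
        | mparse-mword-++ b h s
        | ++ᵐ-identityʳ a
  with mparse h s
... | x ∷ r = refl

mparse-mword : ∀ t → head (mparse 0 (mword t)) ≡ t
mparse-mword t = begin
  head (mparse 0 (mword t))       ≡⟨ cong (head ∘ mparse 0) (++-identityʳ (mword t)) ⟨
  head (mparse 0 (mword t ++ [])) ≡⟨ cong head (mparse-mword-++ t 0 []) ⟩
  t ++ᵐ []                        ≡⟨ ++ᵐ-identityʳ t ⟩
  t                               ∎
  where open ≡-Reasoning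

WellMarkedStack : ∀ {h} → Bool → Vec MForest (suc h) → Set
WellMarkedStack m (a ∷ r) = WellMarked m a × Allᵛ (WellMarked false) r

wellMarked-mparse : ∀ {h m s} → MWalk h m s → WellMarkedStack m (mparse h s)
wellMarked-mparse {h} end = [] , emptyStack h
  where
  emptyStack : ∀ h → Allᵛ (WellMarked false) (replicate h [])
  emptyStack zero    = []
  emptyStack (suc h) = [] ∷ emptyStack h
wellMarked-mparse {h} (upE {s = s} w) with mparse (suc h) s | wellMarked-mparse w
... | a ∷ b ∷ r | wa , wb ∷ wr = ⟨ wa ⟩∷ wb , wr
wellMarked-mparse {h} (upD {s = s} w) with mparse (suc h) s | wellMarked-mparse w
... | a ∷ b ∷ r | wa , wb ∷ wr = ⟨ wa ⟩ᵐ∷ wb , wr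
wellMarked-mparse {suc h} (downN {s = s} w) with mparse h s | wellMarked-mparse w
... | a ∷ r | wa , wr = [] , wa ∷ wr

MDyck : ℕ → List Step → Set
MDyck n s = MWalk 0 false s × xCoord s ≡ n

markedForest≅markedDyck : ∀ n → MForestOf n ≅ MDyck n
markedForest≅markedDyck n = record
  { to      = mword
  ; from    = head ∘ mparse 0
  ; to-∈    = λ {t} (wt , size≡n) →
      subst (MWalk 0 false) (++-identityʳ (mword t)) (mwalk-mword wt end) , trans (xCoord-mword t) size≡n
  ; from-∈  = λ (w , x≡n) →
      wellMarked₀ w , trans (sym (xCoord-mword _)) (trans (cong xCoord (mword-mparse₀ w)) x≡n)
  ; from∘to = λ {t} _ → mparse-mword t
  ; to∘from = λ (w , _) → mword-mparse₀ w
  }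
  where
  mword-mparse₀ : ∀ {s} → MWalk 0 false s → mword (head (mparse 0 s)) ≡ s
  mword-mparse₀ {s} w with mparse 0 s | mstackWord-mparse w
  ... | a ∷ [] | eq = trans (sym (++-identityʳ (mword a))) eq

  wellMarked₀ : ∀ {s} → MWalk 0 false s → WellMarked false (head (mparse 0 s))
  wellMarked₀ {s} w with mparse 0 s | wellMarked-mparse w
  ... | a ∷ [] | wa , _ = wa

-- Sequences

Ns : ℕ → List Step
Ns zero    = []
Ns (suc d) = N ∷ Ns d

-- SeqFrom p m z u: u is the tail, from position p (counted from 1), of a
-- sequence in S_n whose last nonzero entry so far is m; z says whether the
-- next entry may be 0.
data SeqFrom : ℕ → ℕ → Bool → ∀ {n} → Vec ℕ n → Set where
  []    : ∀ {p m z} → SeqFrom p m z []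
  zero∷ : ∀ {p m n} {u : Vec ℕ n} → SeqFrom (suc p) m true u → SeqFrom p m true (0 ∷ u)
  suc∷  : ∀ {p m z k n} {u : Vec ℕ n} → m ≤ suc k → suc k ≤ p →
          SeqFrom (suc p) (suc k) true u → SeqFrom p m z (suc k ∷ u)

-- The i-th up step is a D if u_i = 0, and otherwise an E preceded by u_i − 1
-- down steps in total; m − 1 down steps have been emitted before position p.
encode : ∀ {n} → ℕ → ℕ → Vec ℕ n → List Step
encode p m []          = Ns (p ∸ m)
encode p m (zero ∷ u)  = D ∷ encode (suc p) m u
encode p m (suc k ∷ u) = Ns (suc k ∸ m) ++ E ∷ encode (suc p) (suc k) u

-- decode m n w reads n entries, m − 1 down steps having been read already
-- (padding with 0 once w is exhausted).
decode : ℕ → (n : ℕ) → List Step → Vec ℕ n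
decode m zero    w       = []
decode m (suc n) []      = 0 ∷ decode m n []
decode m (suc n) (N ∷ w) = decode (suc m) (suc n) w
decode m (suc n) (E ∷ w) = m ∷ decode m n w
decode m (suc n) (D ∷ w) = 0 ∷ decode m n w

mwalk-Ns : ∀ d {h s} → (∀ {m} → MWalk h m s) → ∀ {m} → MWalk (d + h) m (Ns d ++ s)
mwalk-Ns zero    w = w
mwalk-Ns (suc d) w = downN (mwalk-Ns d w)

height-split : ∀ {h m j p} → h + m ≡ p → m ≤ j → j ≤ p → h ≡ (j ∸ m) + (p ∸ j)
height-split {h} {m} {j} {p} h+m≡p m≤j j≤p = +-cancelʳ-≡ m h _ (begin
  h + m                       ≡⟨ h+m≡p ⟩
  p                           ≡⟨ m+[n∸m]≡n j≤p ⟨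
  j + (p ∸ j)                 ≡⟨ cong (_+ (p ∸ j)) (m∸n+n≡m m≤j) ⟨
  (j ∸ m) + m + (p ∸ j)       ≡⟨ +-assoc (j ∸ m) m (p ∸ j) ⟩
  (j ∸ m) + (m + (p ∸ j))     ≡⟨ cong ((j ∸ m) +_) (+-comm m (p ∸ j)) ⟩
  (j ∸ m) + ((p ∸ j) + m)     ≡⟨ +-assoc (j ∸ m) (p ∸ j) m ⟨
  (j ∸ m) + (p ∸ j) + m       ∎)
  where open ≡-Reasoning

mwalk-encode : ∀ {p m z n} {u : Vec ℕ n} → SeqFrom p m z u → ∀ h → h + m ≡ p →
               MWalk h z (encode p m u)
mwalk-encode {p} {m} {z} [] h h+m≡p
  rewrite sym h+m≡p | m+n∸n≡m h m = Ns-walk h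
  where
  Ns-walk : ∀ h {z} → MWalk h z (Ns h)
  Ns-walk zero    = end
  Ns-walk (suc h) = downN (Ns-walk h)
mwalk-encode (zero∷ r) h h+m≡p = upD (mwalk-encode r (suc h) (cong suc h+m≡p))
mwalk-encode {p} {m} {z} (suc∷ {k = k} {u = u} m≤ ≤p r) h h+m≡p =
  subst (λ h → MWalk h z (encode p m (suc k ∷ u))) (sym (height-split h+m≡p m≤ ≤p))
    (mwalk-Ns (suc k ∸ m) (upE (mwalk-encode r (suc (p ∸ suc k)) (cong suc (m∸n+n≡m ≤p)))))

decode-Ns : ∀ d m n w → decode m (suc n) (Ns d ++ w) ≡ decode (d + m) (suc n) w
decode-Ns zero    m n w = refl
decode-Ns (suc d) m n w = trans (decode-Ns d (suc m) n w) (cong (λ m′ → decode m′ (suc n) w) (+-suc d m))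

decode-encode : ∀ {p m z n} {u : Vec ℕ n} → SeqFrom p m z u → decode m n (encode p m u) ≡ u
decode-encode []        = refl
decode-encode (zero∷ r) = cong (0 ∷_) (decode-encode r)
decode-encode {p} {m} {n = suc n} (suc∷ {k = k} {u = u} m≤ _ r)
  rewrite decode-Ns (suc k ∸ m) m n (E ∷ encode (suc p) (suc k) u) | m∸n+n≡m m≤ =
  cong (suc k ∷_) (decode-encode r)

mwalk-without-up : ∀ {h m s} → MWalk h m s → xCoord s ≡ 0 → s ≡ Ns h
mwalk-without-up end       _  = refl
mwalk-without-up (downN w) x≡0 = cong (N ∷_) (mwalk-without-up w x≡0)

-- After a down step the next up step is an E, so the next entry is nonzero.
decode-head-nonzero : ∀ {h s n} → MWalk h false s → xCoord s ≡ suc n → ∀ m →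
  Σ ℕ λ k → Σ (Vec ℕ n) λ u → decode (suc m) (suc n) s ≡ suc k ∷ u × m ≤ k
decode-head-nonzero (upE {s = s} w) _ m = m , decode (suc m) _ s , refl , ≤-refl
decode-head-nonzero (downN w) x≡1+n m with decode-head-nonzero w x≡1+n (suc m)
... | k , u , eq , 1+m≤k = k , u , eq , ≤-trans (n≤1+n m) 1+m≤k

encode-N : ∀ {n} p m k (u : Vec ℕ n) → m ≤ k →
           encode p m (suc k ∷ u) ≡ N ∷ encode p (suc m) (suc k ∷ u)
encode-N p m k u m≤k rewrite +-∸-assoc 1 m≤k = refl

encode-decode : ∀ {h z w n} → MWalk h z w → xCoord w ≡ n → ∀ p m → h + suc m ≡ p →
                encode p (suc m) (decode (suc m) n w) ≡ w
encode-decode {n = zero}  end       _  p m h+1+m≡p rewrite sym h+1+m≡p | n∸n≡0 m = refl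
encode-decode {n = suc n} (upE w)   x≡n p m h+1+m≡p rewrite n∸n≡0 m =
  cong (E ∷_) (encode-decode w (suc-injective x≡n) (suc p) m (cong suc h+1+m≡p))
encode-decode {n = suc n} (upD w)   x≡n p m h+1+m≡p =
  cong (D ∷_) (encode-decode w (suc-injective x≡n) (suc p) m (cong suc h+1+m≡p))
encode-decode {suc h} {n = zero} (downN w) x≡0 p m h+1+m≡p
  rewrite sym h+1+m≡p | m+n∸n≡m (suc h) (suc m) = cong (N ∷_) (sym (mwalk-without-up w x≡0))
encode-decode {suc h} {n = suc n} (downN w) x≡n p m h+1+m≡p
  with decode-head-nonzero w x≡n (suc m) | encode-decode w x≡n p (suc m) (trans (+-suc h (suc m)) h+1+m≡p)
... | k , u , eq , 1+m≤k | ih rewrite eq = trans (encode-N p (suc m) k u 1+m≤k) (cong (N ∷_) ih)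

seqFrom-weaken : ∀ {p m z n} {u : Vec ℕ n} → SeqFrom p (suc m) false u → SeqFrom p m z u
seqFrom-weaken []              = []
seqFrom-weaken (suc∷ m≤ ≤p r) = suc∷ (≤-trans (n≤1+n _) m≤) ≤p r

seqFrom-decode : ∀ {h z w n} → MWalk h z w → xCoord w ≡ n → ∀ p m → h + suc m ≡ p →
                 SeqFrom p (suc m) z (decode (suc m) n w)
seqFrom-decode {n = zero}  end       _ p m _ = []
seqFrom-decode {n = zero}  (downN w) _ p m _ = []
seqFrom-decode {h} {n = suc n} (upE w) x≡n p m h+1+m≡p =
  suc∷ ≤-refl (subst (suc m ≤_) h+1+m≡p (m≤n+m (suc m) h))
       (seqFrom-decode w (suc-injective x≡n) (suc p) m (cong suc h+1+m≡p))
seqFrom-decode {n = suc n} (upD w) x≡n p m h+1+m≡p =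
  zero∷ (seqFrom-decode w (suc-injective x≡n) (suc p) m (cong suc h+1+m≡p))
seqFrom-decode {suc h} {n = suc n} (downN w) x≡n p m h+1+m≡p =
  seqFrom-weaken (seqFrom-decode w x≡n p (suc m) (trans (+-suc h (suc m)) h+1+m≡p))

xCoord-Ns : ∀ d → xCoord (Ns d) ≡ 0
xCoord-Ns zero    = refl
xCoord-Ns (suc d) = xCoord-Ns d

xCoord-encode : ∀ {n} p m (u : Vec ℕ n) → xCoord (encode p m u) ≡ n
xCoord-encode p m []          = xCoord-Ns (p ∸ m)
xCoord-encode p m (zero ∷ u)  = cong suc (xCoord-encode (suc p) m u)
xCoord-encode p m (suc k ∷ u) =
  trans (xCoord-++ (Ns (suc k ∸ m)) _)
        (cong₂ _+_ (xCoord-Ns (suc k ∸ m)) (cong suc (xCoord-encode (suc p) (suc k) u)))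

markedDyck≅seqFrom : ∀ n → MDyck n ≅ SeqFrom 1 1 false {n}
markedDyck≅seqFrom n = record
  { to      = decode 1 n
  ; from    = encode 1 1
  ; to-∈    = λ (w , x≡n) → seqFrom-decode w x≡n 1 0 refl
  ; from-∈  = λ {u} r → mwalk-encode r 0 refl , xCoord-encode 1 1 u
  ; from∘to = λ (w , x≡n) → encode-decode w x≡n 1 0 refl
  ; to∘from = decode-encode
  }

record IsSeqFrom (p m : ℕ) {n : ℕ} (u : Vec ℕ n) : Set where
  field
    bounded : (i : Fin n) → lookup u i ≤ p + toℕ i
    above   : (i : Fin n) → lookup u i ≢ 0 → m ≤ lookup u i
    incr    : (i j : Fin n) → toℕ i < toℕ j →
              lookup u i ≢ 0 → lookup u j ≢ 0 → lookup u i ≤ lookup u j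

isSeqFrom-[] : ∀ {p m} → IsSeqFrom p m []
isSeqFrom-[] = record { bounded = λ () ; above = λ () ; incr = λ () }

isSeqFrom-∷ : ∀ {p m m′ x n} {u : Vec ℕ n} →
              x ≤ p → (x ≢ 0 → m ≤ x) → (x ≢ 0 → x ≤ m′) → m ≤ m′ →
              IsSeqFrom (suc p) m′ u → IsSeqFrom p m (x ∷ u)
isSeqFrom-∷ {p} {m} {m′} {x} {u = u} x≤p m≤x x≤m′ m≤m′ s = record
  { bounded = bounded′ ; above = above′ ; incr = incr′ }
  where
  open IsSeqFrom s
  bounded′ : (i : Fin _) → lookup (x ∷ u) i ≤ p + toℕ i
  bounded′ zero    = subst (x ≤_) (sym (+-identityʳ p)) x≤p
  bounded′ (suc i) = subst (lookup u i ≤_) (sym (+-suc p (toℕ i))) (bounded i)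
  above′ : (i : Fin _) → lookup (x ∷ u) i ≢ 0 → m ≤ lookup (x ∷ u) i
  above′ zero    x≢0 = m≤x x≢0
  above′ (suc i) u≢0 = ≤-trans m≤m′ (above i u≢0)
  incr′ : (i j : Fin _) → toℕ i < toℕ j →
          lookup (x ∷ u) i ≢ 0 → lookup (x ∷ u) j ≢ 0 → lookup (x ∷ u) i ≤ lookup (x ∷ u) j
  incr′ zero    (suc j) _         x≢0 u≢0 = ≤-trans (x≤m′ x≢0) (above j u≢0)
  incr′ (suc i) (suc j) (s≤s i<j)         = incr i j i<j

isSeqFrom-tail : ∀ {p m m′ x n} {u : Vec ℕ n} → IsSeqFrom p m (x ∷ u) →
                 ((i : Fin n) → lookup u i ≢ 0 → m′ ≤ lookup u i) → IsSeqFrom (suc p) m′ u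
isSeqFrom-tail {p} {u = u} s above′ = record
  { bounded = λ i → subst (lookup u i ≤_) (+-suc p (toℕ i)) (bounded (suc i))
  ; above   = above′
  ; incr    = λ i j i<j → incr (suc i) (suc j) (s≤s i<j)
  }
  where open IsSeqFrom s

seqFrom⇒isSeqFrom : ∀ {p m z n} {u : Vec ℕ n} → SeqFrom p m z u → IsSeqFrom p m u
seqFrom⇒isSeqFrom []             = isSeqFrom-[]
seqFrom⇒isSeqFrom (zero∷ r)      = isSeqFrom-∷ z≤n 0≢0-elim 0≢0-elim ≤-refl (seqFrom⇒isSeqFrom r)
  where
  0≢0-elim : {A : Set} → 0 ≢ 0 → A
  0≢0-elim 0≢0 = contradiction refl 0≢0
seqFrom⇒isSeqFrom (suc∷ m≤ ≤p r) = isSeqFrom-∷ ≤p (λ _ → m≤) (λ _ → ≤-refl) m≤ (seqFrom⇒isSeqFrom r)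

isSeqFrom⇒seqFrom : ∀ {p m n} (u : Vec ℕ n) → IsSeqFrom p m u → SeqFrom p m true u
isSeqFrom⇒seqFrom []          s = []
isSeqFrom⇒seqFrom (zero ∷ u)  s = zero∷ (isSeqFrom⇒seqFrom u (isSeqFrom-tail s (λ i → above (suc i))))
  where open IsSeqFrom s
isSeqFrom⇒seqFrom {p} (suc k ∷ u) s =
  suc∷ (above zero λ ()) (subst (suc k ≤_) (+-identityʳ p) (bounded zero))
       (isSeqFrom⇒seqFrom u (isSeqFrom-tail s (λ i → incr zero (suc i) (s≤s z≤n) (λ ()))))
  where open IsSeqFrom s

isSeqS⇒isSeqFrom : ∀ {n} {u : Vec ℕ n} → IsSeqS n u → IsSeqFrom 1 1 u
isSeqS⇒isSeqFrom s = record { bounded = bounded ; above = λ _ → n≢0⇒n>0 ; incr = incr }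
  where open IsSeqS s

seqFrom≅isSeqS : ∀ n → SeqFrom 1 1 false {n} ≅ IsSeqS n
seqFrom≅isSeqS n = record
  { to      = id
  ; from    = id
  ; to-∈    = isSeqS
  ; from-∈  = seqFrom _
  ; from∘to = λ _ → refl
  ; to∘from = λ _ → refl
  }
  where
  isSeqS : ∀ {u : Vec ℕ n} → SeqFrom 1 1 false u → IsSeqS n u
  isSeqS []                     = record { first = λ () ; bounded = λ () ; incr = λ () }
  isSeqS r@(suc∷ _ (s≤s z≤n) _) =
    record { first = λ { zero _ → refl } ; bounded = bounded ; incr = incr }
    where open IsSeqFrom (seqFrom⇒isSeqFrom r)

  seqFrom : ∀ (u : Vec ℕ n) → IsSeqS n u → SeqFrom 1 1 false u
  seqFrom []      _ = []
  seqFrom (x ∷ u) s with IsSeqS.first s zero refl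
  ... | refl = suc∷ ≤-refl ≤-refl
                 (isSeqFrom⇒seqFrom u (isSeqFrom-tail (isSeqS⇒isSeqFrom s) (λ _ → n≢0⇒n>0)))

mainTheorem1 : (n : ℕ) → n ≥ 1 → Bijection (LS n) (Seqs n)
mainTheorem1 n _ = Inverse⇒Bijection
  ( ≅⇒Inverse (littleSchröder≅walk n)
  ⨾ ≅⇒Inverse (walk≅forest n)
  ⨾ ≅⇒Inverse (forest≅markedForest n)
  ⨾ ≅⇒Inverse (markedForest≅markedDyck n)
  ⨾ ≅⇒Inverse (markedDyck≅seqFrom n)
  ⨾ ≅⇒Inverse (seqFrom≅isSeqS n))
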